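{- Let $b=\alpha^u$ for some $u\in D$, and let $P$ be the plane $bx+b^qy+b^{q^2}z+b^{q^3}t=0$ in $PG(3,q^4)$. Intersecting $P$ with the quadric $xz-yt=0$ (eliminating $t=xz/y$) gives the conic $O_c$ in coordinates $(x:y:z)$ with equation $b^qy^2+b^{q^2}yz+b^{q^3}xz+bxy=0$. Then: (1) $O_c$ is non-singular if and only if $u\neq\frac{(q^2+1)(q+1)}{2}$; (2) if $u=\frac{(q^2+1)(q+1)}{2}$, then $|P\cap O|=1$.
   Context: $q$ is an odd prime power, $\alpha$ a primitive element of $\mathbb{F}_{q^4}$, $\mathrm{Tr}(a)=a+a^q+a^{q^2}+a^{q^3}$, $D=\{i\in\mathbb{Z}_{(q^2+1)(q+1)}:\mathrm{Tr}(\alpha^i)=0\}$. For an integer $l$, $\omega(l)=(\alpha^l:\alpha^{lq}:\alpha^{lq^2}:\alpha^{lq^3})\in PG(3,q^4)$, and $O=\{\omega(i(q+1)):0\le i\le q^2\}$ is the image of the ovoid $\{L(\alpha^{(q+1)i})\}$ of $PG(3,q)$ ($L$ = coordinates in the basis $1,\alpha,\alpha^2,\alpha^3$); its points satisfy $xz-yt=0$. A conic is non-singular if its associated symmetric matrix is non-singular. -}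

module Defs where

open import Level using (0ℓ)
open import Data.Nat as ℕ using (ℕ; zero; suc)
open import Data.Nat.Primality using (Prime)
open import Data.Fin using (Fin) renaming (zero to fz; suc to fs)
open import Data.Product using (Σ; ∃; _×_; _,_)
open import Function.Bundles using (_↔_)
open import Relation.Binary.PropositionalEquality using (_≡_; _≢_)
open import Relation.Nullary using (Dec)
open import Algebra.Structures using (IsCommutativeRing)

OddPrimePower : ℕ → Set
OddPrimePower q = Σ ℕ λ p → Σ ℕ λ k →
  Prime p × (p ≢ 2) × (1 ℕ.≤ k) × (q ≡ p ℕ.^ k)

record FiniteField (n : ℕ) : Set₁ where
  infixl 7 _*_
  infixl 6 _+_
  field
    F     : Set
    _+_   : F → F → F
    _*_   : F → F → F
    -_    : F → F
    0#    : F
    1#    : F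
    _⁻¹   : F → F
    isCommutativeRing : IsCommutativeRing _≡_ _+_ _*_ -_ 0# 1#
    0≢1   : 0# ≢ 1#
    inverseʳ : ∀ x → x ≢ 0# → x * (x ⁻¹) ≡ 1#
    _≟_   : (x y : F) → Dec (x ≡ y)
    card  : F ↔ Fin n

  _^_ : F → ℕ → F
  x ^ zero  = 1#
  x ^ suc m = x * (x ^ m)

  IsPrimitive : F → Set
  IsPrimitive a = ∀ x → x ≢ 0# → ∃ λ i → a ^ i ≡ x

module Setup (q : ℕ) (K : FiniteField (q ℕ.^ 4)) (α : FiniteField.F K) where
  open FiniteField K public

  Tr : F → F
  Tr a = a + a ^ q + a ^ (q ℕ.^ 2) + a ^ (q ℕ.^ 3)

  N : ℕ
  N = (q ℕ.^ 2 ℕ.+ 1) ℕ.* (q ℕ.+ 1)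

  -- u ∈ D  (u taken as a representative 0 ≤ u < N)
  InD : ℕ → Set
  InD u = (u ℕ.< N) × (Tr (α ^ u) ≡ 0#)

  record Pt : Set where
    constructor ⟨_,_,_,_⟩
    field x y z t : F

  _∼_ : Pt → Pt → Set
  ⟨ x , y , z , t ⟩ ∼ ⟨ x' , y' , z' , t' ⟩ =
    Σ F λ c → (c ≢ 0#) × (x' ≡ c * x) × (y' ≡ c * y) × (z' ≡ c * z) × (t' ≡ c * t)

  ω : ℕ → Pt
  ω l = ⟨ α ^ l , α ^ (l ℕ.* q) , α ^ (l ℕ.* q ℕ.^ 2) , α ^ (l ℕ.* q ℕ.^ 3) ⟩

  InO : Pt → Set
  InO P = Σ ℕ λ i → (i ℕ.≤ q ℕ.^ 2) × (P ∼ ω (i ℕ.* (q ℕ.+ 1)))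

  OnPlane : F → Pt → Set
  OnPlane b ⟨ x , y , z , t ⟩ =
    b * x + b ^ q * y + b ^ (q ℕ.^ 2) * z + b ^ (q ℕ.^ 3) * t ≡ 0#

  Mat3 : Set
  Mat3 = Fin 3 → Fin 3 → F

  f0 f1 f2 : Fin 3
  f0 = fz
  f1 = fs fz
  f2 = fs (fs fz)

  det3 : Mat3 → F
  det3 M =
      M f0 f0 * (M f1 f1 * M f2 f2 + - (M f1 f2 * M f2 f1))
    + - (M f0 f1 * (M f1 f0 * M f2 f2 + - (M f1 f2 * M f2 f0)))
    + M f0 f2 * (M f1 f0 * M f2 f1 + - (M f1 f1 * M f2 f0))

  half : F
  half = (1# + 1#) ⁻¹

  -- symmetric matrix of the conic
  --   b^q y^2 + b^{q^2} y z + b^{q^3} x z + b x y = 0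
  -- in the coordinates (x, y, z)
  conicMatrix : F → Mat3
  conicMatrix b fz fz = 0#
  conicMatrix b fz (fs fz) = half * b
  conicMatrix b fz (fs (fs fz)) = half * b ^ (q ℕ.^ 3)
  conicMatrix b (fs fz) fz = half * b
  conicMatrix b (fs fz) (fs fz) = b ^ q
  conicMatrix b (fs fz) (fs (fs fz)) = half * b ^ (q ℕ.^ 2)
  conicMatrix b (fs (fs fz)) fz = half * b ^ (q ℕ.^ 3)
  conicMatrix b (fs (fs fz)) (fs fz) = half * b ^ (q ℕ.^ 2)
  conicMatrix b (fs (fs fz)) (fs (fs fz)) = 0#

  NonSingularConic : F → Set
  NonSingularConic b = det3 (conicMatrix b) ≢ 0#

  ExactlyOneOnPlane : F → Set
  ExactlyOneOnPlane b =
    (Σ Pt λ P → InO P × OnPlane b P) ×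
    (∀ P Q → InO P → OnPlane b P → InO Q → OnPlane b Q → P ∼ Q)

{-# OPTIONS --safe #-}
module Submission where

-- Write b = α^u and bᵢ = b^(qⁱ). As 2 is invertible, det O_c = ¼·b₃·(b·b₂ − b₁·b₃),
-- so O_c is singular iff b·b₂ = b₁·b₃. For x ≠ 0 of trace 0 with x·x₂ = x₁·x₃ the identity
--   x·x₁·(x + x₁ + x₂ + x₃) = (x + x₁)·x·(x₁ + x₂) + x·(x·x₂ − x₁·x₃)
-- forces x₁ = −x: otherwise x₁^q = x₂ = −x₁ = (−x)^q, and x ↦ x^q is injective since
-- x^(q⁴) = x. Conversely b^q = −b gives b·b₂ = b² = b₁·b₃. Finally, for u < N,
-- b^q = −b means α^(u(q−1)) = −1 = α^((q⁴−1)/2), i.e. u = N/2.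
-- Then the plane is b(x − y + z − t) = 0. If ω(l), l = i(q+1), lies on it, A = α^l
-- satisfies A·A₂ = A₁·A₃ and the plane equation says that b·A has trace 0, so the same
-- identity gives (bA)^q = −bA, i.e. A^(q−1) = 1; for i ≤ q² this forces i = 0.

open import Defs
open import Data.Nat using (ℕ; _/_)
open import Data.Product using (_×_)
open import Function.Bundles using (_⇔_)
open import Relation.Binary.PropositionalEquality using (_≡_; _≢_)

open import Algebra.Bundles using (CommutativeRing; RawRing)
open import Data.Empty using (⊥-elim)
open import Data.Maybe using (Maybe; just; nothing)
open import Data.Nat as ℕ using (zero; suc; _%_)
import Data.Nat.Properties as ℕP
open import Data.Product using (∃; _,_; proj₁; proj₂; swap)
open import Data.Sum as Sum using (_⊎_; inj₁; inj₂)
open import Function using (_∘_; mk⇔; Equivalence)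
import Function.Properties.Equivalence as ⇔
open import Function.Related.TypeIsomorphisms using (¬-cong-⇔)
open import Level using (0ℓ)
import Relation.Binary.PropositionalEquality as ≡
open import Relation.Nullary using (yes; no)

module DifferenceCoefficients {c ℓ} (R : CommutativeRing c ℓ) where
  open CommutativeRing R
  open import Algebra.Properties.Ring ring using (-‿+-comm; ⁻¹-anti-homo‿-; [y-z]x≈yx-zx; x[y-z]≈xy-xz; -0#≈0#)
  open import Algebra.Properties.CommutativeSemigroup +-commutativeSemigroup using (interchange)
  open import Algebra.Properties.Semiring.Mult semiring using (×-homo-+; ×1-homo-*) renaming (_×_ to _·_)
  open import Algebra.Solver.Ring.AlmostCommutativeRing using (fromCommutativeRing; _-Raw-AlmostCommutative⟶_)
  open import Relation.Binary.Reasoning.Setoid setoid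

  -- The ring solver needs coefficients whose equality computes, which F's does
  -- not. Here (a , b) stands for the integer a − b, and normalise cancels common
  -- units so that equal integers get equal representatives.
  normalise : ℕ → ℕ → ℕ × ℕ
  normalise (suc a) (suc b) = normalise a b
  normalise a       b       = a , b

  _⊕_ _⊛_ : ℕ × ℕ → ℕ × ℕ → ℕ × ℕ
  (a , b) ⊕ (c , d) = normalise (a ℕ.+ c) (b ℕ.+ d)
  (a , b) ⊛ (c , d) = normalise (a ℕ.* c ℕ.+ b ℕ.* d) (a ℕ.* d ℕ.+ b ℕ.* c)

  differences : RawRing 0ℓ 0ℓ
  differences = record
    { Carrier = ℕ × ℕ ; _≈_ = _≡_ ; _+_ = _⊕_ ; _*_ = _⊛_ ; -_ = swap
    ; 0# = 0 , 0 ; 1# = 1 , 0 }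

  ⟦_⟧ : ℕ × ℕ → Carrier
  ⟦ a , b ⟧ = a · 1# - b · 1#

  [x+y]-[x+z]≈y-z : ∀ x y z → (x + y) - (x + z) ≈ y - z
  [x+y]-[x+z]≈y-z x y z = begin
    (x + y) - (x + z)       ≈⟨ +-congˡ (-‿+-comm x z) ⟨
    (x + y) + (- x + - z)   ≈⟨ interchange x y (- x) (- z) ⟩
    (x - x) + (y - z)       ≈⟨ +-congʳ (-‿inverseʳ x) ⟩
    0# + (y - z)            ≈⟨ +-identityˡ (y - z) ⟩
    y - z                   ∎

  normalise-sound : ∀ a b → ⟦ normalise a b ⟧ ≈ a · 1# - b · 1#
  normalise-sound zero    b       = refl
  normalise-sound (suc a) zero    = refl
  normalise-sound (suc a) (suc b) =
    trans (normalise-sound a b) (sym ([x+y]-[x+z]≈y-z 1# (a · 1#) (b · 1#)))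

  ⊕-homo : ∀ p q → ⟦ p ⊕ q ⟧ ≈ ⟦ p ⟧ + ⟦ q ⟧
  ⊕-homo (a , b) (c , d) = begin
    ⟦ normalise (a ℕ.+ c) (b ℕ.+ d) ⟧   ≈⟨ normalise-sound (a ℕ.+ c) (b ℕ.+ d) ⟩
    (a ℕ.+ c) · 1# - (b ℕ.+ d) · 1#     ≈⟨ +-cong (×-homo-+ 1# a c) (-‿cong (×-homo-+ 1# b d)) ⟩
    (A + C) - (B + D)                   ≈⟨ +-congˡ (-‿+-comm B D) ⟨
    (A + C) + (- B + - D)               ≈⟨ interchange A C (- B) (- D) ⟩
    (A - B) + (C - D)                   ∎
    where A = a · 1#; B = b · 1#; C = c · 1#; D = d · 1#

  ⊛-homo : ∀ p q → ⟦ p ⊛ q ⟧ ≈ ⟦ p ⟧ * ⟦ q ⟧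
  ⊛-homo (a , b) (c , d) = begin
    ⟦ normalise (a ℕ.* c ℕ.+ b ℕ.* d) (a ℕ.* d ℕ.+ b ℕ.* c) ⟧
      ≈⟨ normalise-sound (a ℕ.* c ℕ.+ b ℕ.* d) (a ℕ.* d ℕ.+ b ℕ.* c) ⟩
    (a ℕ.* c ℕ.+ b ℕ.* d) · 1# - (a ℕ.* d ℕ.+ b ℕ.* c) · 1#
      ≈⟨ +-cong (×-homo-+ 1# (a ℕ.* c) (b ℕ.* d)) (-‿cong (×-homo-+ 1# (a ℕ.* d) (b ℕ.* c))) ⟩
    ((a ℕ.* c) · 1# + (b ℕ.* d) · 1#) - ((a ℕ.* d) · 1# + (b ℕ.* c) · 1#)
      ≈⟨ +-cong (+-cong (×1-homo-* a c) (×1-homo-* b d)) (-‿cong (+-cong (×1-homo-* a d) (×1-homo-* b c))) ⟩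
    (A * C + B * D) - (A * D + B * C)
      ≈⟨ +-congˡ (trans (-‿cong (+-comm (A * D) (B * C))) (sym (-‿+-comm (B * C) (A * D)))) ⟩
    (A * C + B * D) + (- (B * C) + - (A * D))
      ≈⟨ interchange (A * C) (B * D) (- (B * C)) (- (A * D)) ⟩
    (A * C - B * C) + (B * D - A * D)
      ≈⟨ +-congˡ (⁻¹-anti-homo‿- (A * D) (B * D)) ⟨
    (A * C - B * C) - (A * D - B * D)
      ≈⟨ +-cong ([y-z]x≈yx-zx C A B) (-‿cong ([y-z]x≈yx-zx D A B)) ⟨
    (A - B) * C - (A - B) * D
      ≈⟨ x[y-z]≈xy-xz (A - B) C D ⟨
    (A - B) * (C - D) ∎
    where A = a · 1#; B = b · 1#; C = c · 1#; D = d · 1#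

  swap-homo : ∀ p → ⟦ swap p ⟧ ≈ - ⟦ p ⟧
  swap-homo (a , b) = sym (⁻¹-anti-homo‿- (a · 1#) (b · 1#))

  homomorphism : differences -Raw-AlmostCommutative⟶ fromCommutativeRing R
  homomorphism = record
    { ⟦_⟧ = ⟦_⟧ ; +-homo = ⊕-homo ; *-homo = ⊛-homo ; -‿homo = swap-homo
    ; 0-homo = trans (+-identityˡ _) -0#≈0#
    ; 1-homo = trans (+-congʳ (+-identityʳ 1#)) (trans (+-congˡ -0#≈0#) (+-identityʳ 1#)) }

  coefficient≟ : ∀ p q → Maybe (⟦ p ⟧ ≈ ⟦ q ⟧)
  coefficient≟ (a , b) (c , d) with a ℕ.≟ c | b ℕ.≟ d
  ... | yes ≡.refl | yes ≡.refl = just refl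
  ... | _          | _          = nothing

module CommutativeRingSolver {c ℓ} (R : CommutativeRing c ℓ) where
  open DifferenceCoefficients R using (differences; homomorphism; coefficient≟)
  open import Algebra.Solver.Ring.AlmostCommutativeRing using (fromCommutativeRing)
  open import Algebra.Solver.Ring differences (fromCommutativeRing R) homomorphism coefficient≟ public

module FieldProperties {n : ℕ} (K : FiniteField n) where
  open ≡
  open ≡-Reasoning
  open FiniteField K public

  commutativeRing : CommutativeRing 0ℓ 0ℓ
  commutativeRing = record { isCommutativeRing = isCommutativeRing }

  open CommutativeRing commutativeRing public
    using (_-_; distribʳ; +-identityˡ; +-identityʳ; *-identityˡ; *-identityʳ; *-assoc; zeroˡ; zeroʳ; -‿inverseʳ)
  open CommutativeRing commutativeRing using (ring; commutativeSemiring)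
  open import Algebra.Properties.Ring ring public
    using ( -‿distribˡ-*; -‿distribʳ-*; -‿involutive; -‿injective; +-inverseʳ-unique
          ; x∙y⁻¹≈ε⇒x≈y; x≈y⇒x∙y⁻¹≈ε)
  open CommutativeRingSolver commutativeRing public
    using (solve; _:=_; _:+_; _:*_; _:-_; :-_; con)
  import Algebra.Properties.CommutativeSemiring.Exp commutativeSemiring as Exp

  ^-agrees : ∀ x k → x ^ k ≡ x Exp.^ k
  ^-agrees x zero    = refl
  ^-agrees x (suc k) = cong (x *_) (^-agrees x k)

  ^-homo-* : ∀ x a b → x ^ (a ℕ.+ b) ≡ x ^ a * x ^ b
  ^-homo-* x a b rewrite ^-agrees x (a ℕ.+ b) | ^-agrees x a | ^-agrees x b = Exp.^-homo-* x a b

  ^-assocʳ : ∀ x a b → (x ^ a) ^ b ≡ x ^ (a ℕ.* b)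
  ^-assocʳ x a b rewrite ^-agrees (x ^ a) b | ^-agrees x a | ^-agrees x (a ℕ.* b) = Exp.^-assocʳ x a b

  ^-distrib-* : ∀ x y k → (x * y) ^ k ≡ x ^ k * y ^ k
  ^-distrib-* x y k rewrite ^-agrees (x * y) k | ^-agrees x k | ^-agrees y k = Exp.^-distrib-* x y k

  1^≡1 : ∀ k → 1# ^ k ≡ 1#
  1^≡1 zero    = refl
  1^≡1 (suc k) = trans (*-identityˡ _) (1^≡1 k)

  ^≡1⇒^≡^% : ∀ {x k} .{{_ : ℕ.NonZero k}} → x ^ k ≡ 1# → ∀ i → x ^ i ≡ x ^ (i % k)
  ^≡1⇒^≡^% {x} {k} x^k≡1 i = begin
    x ^ i                               ≡⟨ cong (x ^_) (m≡m%n+[m/n]*n i k) ⟩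
    x ^ (i % k ℕ.+ (i / k) ℕ.* k)       ≡⟨ ^-homo-* x (i % k) _ ⟩
    x ^ (i % k) * x ^ ((i / k) ℕ.* k)   ≡⟨ cong (λ e → x ^ (i % k) * x ^ e) (ℕP.*-comm (i / k) k) ⟩
    x ^ (i % k) * x ^ (k ℕ.* (i / k))   ≡⟨ cong (x ^ (i % k) *_) (^-assocʳ x k (i / k)) ⟨
    x ^ (i % k) * (x ^ k) ^ (i / k)     ≡⟨ cong (λ y → x ^ (i % k) * y ^ (i / k)) x^k≡1 ⟩
    x ^ (i % k) * 1# ^ (i / k)          ≡⟨ cong (x ^ (i % k) *_) (1^≡1 (i / k)) ⟩
    x ^ (i % k) * 1#                    ≡⟨ *-identityʳ _ ⟩
    x ^ (i % k)                         ∎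
    where open import Data.Nat.DivMod using (m≡m%n+[m/n]*n)

  1≢0 : 1# ≢ 0#
  1≢0 = ≢-sym 0≢1

  ⁻¹*-cancel : ∀ {a} x → a ≢ 0# → a ⁻¹ * (a * x) ≡ x
  ⁻¹*-cancel {a} x a≢0 = begin
    a ⁻¹ * (a * x)   ≡⟨ solve 3 (λ a b x → b :* (a :* x) := (a :* b) :* x) refl a (a ⁻¹) x ⟩
    (a * a ⁻¹) * x   ≡⟨ cong (_* x) (inverseʳ a a≢0) ⟩
    1# * x           ≡⟨ *-identityˡ x ⟩
    x                ∎

  *-cancelˡ : ∀ {a x y} → a ≢ 0# → a * x ≡ a * y → x ≡ y
  *-cancelˡ {a} {x} {y} a≢0 ax≡ay = begin
    x                ≡⟨ ⁻¹*-cancel x a≢0 ⟨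
    a ⁻¹ * (a * x)   ≡⟨ cong (a ⁻¹ *_) ax≡ay ⟩
    a ⁻¹ * (a * y)   ≡⟨ ⁻¹*-cancel y a≢0 ⟩
    y                ∎

  *≡0⇒≡0 : ∀ {a b} → a * b ≡ 0# → a ≡ 0# ⊎ b ≡ 0#
  *≡0⇒≡0 {a} {b} ab≡0 with a ≟ 0#
  ... | yes a≡0 = inj₁ a≡0
  ... | no  a≢0 = inj₂ (*-cancelˡ a≢0 (trans ab≡0 (sym (zeroʳ a))))

  *-≢0 : ∀ {a b} → a ≢ 0# → b ≢ 0# → a * b ≢ 0#
  *-≢0 a≢0 b≢0 = Sum.[ a≢0 , b≢0 ] ∘ *≡0⇒≡0

  ^-≢0 : ∀ {a} k → a ≢ 0# → a ^ k ≢ 0#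
  ^-≢0 zero    a≢0 = 1≢0
  ^-≢0 (suc k) a≢0 = *-≢0 a≢0 (^-≢0 k a≢0)

  ⁻¹-≢0 : ∀ {a} → a ≢ 0# → a ⁻¹ ≢ 0#
  ⁻¹-≢0 {a} a≢0 a⁻¹≡0 = 1≢0 (begin
    1#          ≡⟨ inverseʳ a a≢0 ⟨
    a * a ⁻¹    ≡⟨ cong (a *_) a⁻¹≡0 ⟩
    a * 0#      ≡⟨ zeroʳ a ⟩
    0#          ∎)

  x*x≡1⇒x≡±1 : ∀ x → x * x ≡ 1# → x ≡ 1# ⊎ x ≡ - 1#
  x*x≡1⇒x≡±1 x x*x≡1 =
    Sum.map (x∙y⁻¹≈ε⇒x≈y x 1#) (x∙y⁻¹≈ε⇒x≈y x (- 1#)) (*≡0⇒≡0 (begin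
      (x - 1#) * (x - - 1#)   ≡⟨ solve 2 (λ x o → (x :- o) :* (x :- :- o) := x :* x :- o :* o) refl x 1# ⟩
      x * x - 1# * 1#         ≡⟨ cong₂ _-_ x*x≡1 (*-identityˡ 1#) ⟩
      1# - 1#                 ≡⟨ -‿inverseʳ 1# ⟩
      0#                      ∎))

  -‿^-odd : ∀ x k → (- x) ^ suc (k ℕ.+ k) ≡ - (x ^ suc (k ℕ.+ k))
  -‿^-odd x k = begin
    - x * (- x) ^ (k ℕ.+ k)       ≡⟨ cong (- x *_) (^-homo-* (- x) k k) ⟩
    - x * ((- x) ^ k * (- x) ^ k) ≡⟨ cong (- x *_) (^-distrib-* (- x) (- x) k) ⟨
    - x * (- x * - x) ^ k         ≡⟨ cong (λ y → - x * y ^ k) (solve 1 (λ x → (:- x) :* (:- x) := x :* x) refl x) ⟩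
    - x * (x * x) ^ k             ≡⟨ cong (- x *_) (^-distrib-* x x k) ⟩
    - x * (x ^ k * x ^ k)         ≡⟨ cong (- x *_) (^-homo-* x k k) ⟨
    - x * x ^ (k ℕ.+ k)           ≡⟨ -‿distribˡ-* x _ ⟨
    - (x * x ^ (k ℕ.+ k))         ∎

  ^≡^⇒^∸≡1 : ∀ {x a b} → x ≢ 0# → a ℕ.≤ b → x ^ a ≡ x ^ b → x ^ (b ℕ.∸ a) ≡ 1#
  ^≡^⇒^∸≡1 {x} {a} {b} x≢0 a≤b x^a≡x^b = *-cancelˡ (^-≢0 a x≢0) (begin
    x ^ a * x ^ (b ℕ.∸ a)   ≡⟨ ^-homo-* x a (b ℕ.∸ a) ⟨
    x ^ (a ℕ.+ (b ℕ.∸ a))   ≡⟨ cong (x ^_) (ℕP.m+[n∸m]≡n a≤b) ⟩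
    x ^ b                   ≡⟨ x^a≡x^b ⟨
    x ^ a                   ≡⟨ *-identityʳ (x ^ a) ⟨
    x ^ a * 1#              ∎)

-- The hypothesis 1 < m is needed: in the two-element field 0# satisfies
-- IsPrimitive, since 1# = 0# ^ 0 is its only non-zero element.
module PrimitiveElement {n m : ℕ} (K : FiniteField n) (n≡1+m : n ≡ suc m) (1<m : 1 ℕ.< m)
                        (α : FiniteField.F K) (α-primitive : FiniteField.IsPrimitive K α) where
  open ≡
  open ≡-Reasoning
  open FieldProperties K
  open import Data.Fin as Fin using (Fin; toℕ; fromℕ<; punchIn; punchOut)
  open import Data.Fin.Properties
    using (punchIn-injective; punchInᵢ≢i; punchOut-injective; injective⇒≤; pigeonhole; toℕ-fromℕ<; toℕ<n)
  open import Data.Nat.DivMod using (m%n<n)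
  open import Function using (_↔_; Inverse; Injection)
  open import Function.Properties.Inverse using (↔⇒↣; ↔-sym)
  open import Relation.Binary.Definitions using (tri<; tri≈; tri>)

  private
    elements : F ↔ Fin (suc m)
    elements = subst (λ k → F ↔ Fin k) n≡1+m card
    open Inverse elements using (to; from; strictlyInverseˡ)

    to-injective : ∀ {x y} → to x ≡ to y → x ≡ y
    to-injective = Injection.injective (↔⇒↣ elements)

    from-injective : ∀ {i j} → from i ≡ from j → i ≡ j
    from-injective = Injection.injective (↔⇒↣ (↔-sym elements))

    nonzero : Fin m → F
    nonzero j = from (punchIn (to 0#) j)

    nonzero-≢0 : ∀ j → nonzero j ≢ 0#
    nonzero-≢0 j nonzero≡0 = punchInᵢ≢i (to 0#) j (trans (sym (strictlyInverseˡ _)) (cong to nonzero≡0))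

    position : ∀ {x} → x ≢ 0# → Fin m
    position {x} x≢0 = punchOut {i = to 0#} {j = to x} (x≢0 ∘ sym ∘ to-injective)

    position-injective : ∀ {x y} (x≢0 : x ≢ 0#) (y≢0 : y ≢ 0#) → position x≢0 ≡ position y≢0 → x ≡ y
    position-injective {x} {y} _ _ = to-injective ∘ punchOut-injective {i = to 0#} {j = to x} {k = to y} _ _

  covering⇒m≤ : ∀ {k} (f : Fin k → F) → (∀ x → x ≢ 0# → ∃ λ j → f j ≡ x) → m ℕ.≤ k
  covering⇒m≤ f covering = injective⇒≤ preimage-injective
    where
    preimage : Fin m → Fin _
    preimage j = proj₁ (covering (nonzero j) (nonzero-≢0 j))
    preimage-injective : ∀ {i j} → preimage i ≡ preimage j → i ≡ j
    preimage-injective {i} {j} same = punchIn-injective (to 0#) i j (from-injective (begin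
      nonzero i          ≡⟨ proj₂ (covering (nonzero i) (nonzero-≢0 i)) ⟨
      f (preimage i)     ≡⟨ cong f same ⟩
      f (preimage j)     ≡⟨ proj₂ (covering (nonzero j) (nonzero-≢0 j)) ⟩
      nonzero j          ∎))

  α≢0 : α ≢ 0#
  α≢0 α≡0 = ℕP.<⇒≱ 1<m (covering⇒m≤ (λ _ → 1#) only-1)
    where
    only-1 : ∀ x → x ≢ 0# → ∃ λ (_ : Fin 1) → 1# ≡ x
    only-1 x x≢0 with α-primitive x x≢0
    ... | zero  , 1≡x     = Fin.zero , 1≡x
    ... | suc i , α^1+i≡x = ⊥-elim (x≢0 (trans (sym α^1+i≡x) (trans (cong (_* (α ^ i)) α≡0) (zeroˡ _))))

  ^≡1⇒m≤ : ∀ {k} → 0 ℕ.< k → α ^ k ≡ 1# → m ℕ.≤ k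
  ^≡1⇒m≤ {k} 0<k α^k≡1 = covering⇒m≤ (λ j → α ^ toℕ j) reduce
    where
    instance _ = ℕ.>-nonZero 0<k
    reduce : ∀ x → x ≢ 0# → ∃ λ j → α ^ toℕ j ≡ x
    reduce x x≢0 with α-primitive x x≢0
    ... | i , α^i≡x = fromℕ< (m%n<n i k) , (begin
      α ^ toℕ (fromℕ< (m%n<n i k))  ≡⟨ cong (α ^_) (toℕ-fromℕ< (m%n<n i k)) ⟩
      α ^ (i % k)                  ≡⟨ ^≡1⇒^≡^% α^k≡1 i ⟨
      α ^ i                        ≡⟨ α^i≡x ⟩
      x                            ∎)

  private
    ^-distinct : ∀ {a b} → a ℕ.< b → b ℕ.< m → α ^ a ≢ α ^ b
    ^-distinct {a} {b} a<b b<m α^a≡α^b = ℕP.<⇒≱ (ℕP.≤-<-trans (ℕP.m∸n≤m b a) b<m)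
      (^≡1⇒m≤ (ℕP.m<n⇒0<n∸m a<b) (^≡^⇒^∸≡1 α≢0 (ℕP.<⇒≤ a<b) α^a≡α^b))

  ^-injective : ∀ {a b} → a ℕ.< m → b ℕ.< m → α ^ a ≡ α ^ b → a ≡ b
  ^-injective {a} {b} a<m b<m α^a≡α^b with ℕP.<-cmp a b
  ... | tri< a<b _ _ = ⊥-elim (^-distinct a<b b<m α^a≡α^b)
  ... | tri≈ _ a≡b _ = a≡b
  ... | tri> _ _ b<a = ⊥-elim (^-distinct b<a a<m (sym α^a≡α^b))

  α^m≡1 : α ^ m ≡ 1#
  α^m≡1 with pigeonhole (ℕP.n<1+n m) (λ j → position (^-≢0 (toℕ j) α≢0))
  ... | i , j , i<j , same = subst (λ d → α ^ d ≡ 1#) d≡m α^d≡1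
    where
    α^d≡1 : α ^ (toℕ j ℕ.∸ toℕ i) ≡ 1#
    α^d≡1 = ^≡^⇒^∸≡1 {a = toℕ i} α≢0 (ℕP.<⇒≤ i<j)
      (position-injective (^-≢0 (toℕ i) α≢0) (^-≢0 (toℕ j) α≢0) same)
    d≡m : toℕ j ℕ.∸ toℕ i ≡ m
    d≡m = ℕP.≤-antisym (ℕP.≤-trans (ℕP.m∸n≤m (toℕ j) (toℕ i)) (ℕP.≤-pred (toℕ<n j)))
                       (^≡1⇒m≤ (ℕP.m<n⇒0<n∸m i<j) α^d≡1)

  ^m≡1 : ∀ {x} → x ≢ 0# → x ^ m ≡ 1#
  ^m≡1 {x} x≢0 with α-primitive x x≢0
  ... | i , refl = begin
    (α ^ i) ^ m     ≡⟨ ^-assocʳ α i m ⟩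
    α ^ (i ℕ.* m)   ≡⟨ cong (α ^_) (ℕP.*-comm i m) ⟩
    α ^ (m ℕ.* i)   ≡⟨ ^-assocʳ α m i ⟨
    (α ^ m) ^ i     ≡⟨ cong (_^ i) α^m≡1 ⟩
    1# ^ i          ≡⟨ 1^≡1 i ⟩
    1#              ∎

  ^[1+m]≡id : ∀ x → x ^ suc m ≡ x
  ^[1+m]≡id x with x ≟ 0#
  ... | yes refl = zeroˡ _
  ... | no  x≢0  = trans (cong (x *_) (^m≡1 x≢0)) (*-identityʳ x)

  α^h≢1 : ∀ {h} → m ≡ h ℕ.+ h → α ^ h ≢ 1#
  α^h≢1 {zero}  refl = ⊥-elim (ℕP.<⇒≱ 1<m ℕ.z≤n)
  α^h≢1 {suc h} m≡h+h α^h≡1 = ℕP.1+n≢0 (^-injective h<m (ℕP.<-trans ℕP.0<1+n h<m) α^h≡1)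
    where
    h<m : suc h ℕ.< m
    h<m = subst (suc h ℕ.<_) (sym m≡h+h) (ℕP.m<m+n (suc h) ℕP.0<1+n)

  α^h≡-1 : ∀ {h} → m ≡ h ℕ.+ h → α ^ h ≡ - 1#
  α^h≡-1 {h} m≡h+h = Sum.fromInj₂ (⊥-elim ∘ α^h≢1 {h} m≡h+h) (x*x≡1⇒x≡±1 (α ^ h) (begin
    α ^ h * α ^ h     ≡⟨ ^-homo-* α h h ⟨
    α ^ (h ℕ.+ h)     ≡⟨ cong (α ^_) m≡h+h ⟨
    α ^ m             ≡⟨ α^m≡1 ⟩
    1#                ∎))

  1+1≢0 : ∀ {h} → m ≡ h ℕ.+ h → 1# + 1# ≢ 0#
  1+1≢0 {h} m≡h+h 1+1≡0 = α^h≢1 {h} m≡h+h (trans (α^h≡-1 {h} m≡h+h) (sym 1≡-1))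
    where
    1≡-1 : 1# ≡ - 1#
    1≡-1 = x∙y⁻¹≈ε⇒x≈y 1# (- 1#) (trans (cong (1# +_) (-‿involutive 1#)) 1+1≡0)

module Frobenius {n : ℕ} (K : FiniteField n) (q : ℕ) {k : ℕ} (q≡1+2k : q ≡ suc (k ℕ.+ k))
                 (^q⁴≡id : ∀ x → FiniteField._^_ K x (q ℕ.^ 4) ≡ x) where
  open ≡
  open ≡-Reasoning
  open FieldProperties K

  ^q²≡^q^q : ∀ x → x ^ (q ℕ.^ 2) ≡ (x ^ q) ^ q
  ^q²≡^q^q x = trans (cong (λ e → x ^ (q ℕ.* e)) (ℕP.*-identityʳ q)) (sym (^-assocʳ x q q))

  ^q³≡^q²^q : ∀ x → x ^ (q ℕ.^ 3) ≡ (x ^ (q ℕ.^ 2)) ^ q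
  ^q³≡^q²^q x = trans (cong (x ^_) (ℕP.*-comm q (q ℕ.^ 2))) (sym (^-assocʳ x (q ℕ.^ 2) q))

  ^q-injective : ∀ {x y} → x ^ q ≡ y ^ q → x ≡ y
  ^q-injective {x} {y} x^q≡y^q = begin
    x                    ≡⟨ ^q⁴≡id x ⟨
    x ^ (q ℕ.* q ℕ.^ 3)  ≡⟨ ^-assocʳ x q (q ℕ.^ 3) ⟨
    (x ^ q) ^ (q ℕ.^ 3)  ≡⟨ cong (_^ (q ℕ.^ 3)) x^q≡y^q ⟩
    (y ^ q) ^ (q ℕ.^ 3)  ≡⟨ ^-assocʳ y q (q ℕ.^ 3) ⟩
    y ^ (q ℕ.* q ℕ.^ 3)  ≡⟨ ^q⁴≡id y ⟩
    y                    ∎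

  -‿^q : ∀ x → (- x) ^ q ≡ - (x ^ q)
  -‿^q x rewrite q≡1+2k = -‿^-odd x k

  b^q≡-b⇒b^q²≡b : ∀ {b} → b ^ q ≡ - b → b ^ (q ℕ.^ 2) ≡ b
  b^q≡-b⇒b^q²≡b {b} b^q≡-b = begin
    b ^ (q ℕ.^ 2)   ≡⟨ ^q²≡^q^q b ⟩
    (b ^ q) ^ q     ≡⟨ cong (_^ q) b^q≡-b ⟩
    (- b) ^ q       ≡⟨ -‿^q b ⟩
    - (b ^ q)       ≡⟨ cong -_ b^q≡-b ⟩
    - (- b)         ≡⟨ -‿involutive b ⟩
    b               ∎

  b^q≡-b⇒b^q³≡-b : ∀ {b} → b ^ q ≡ - b → b ^ (q ℕ.^ 3) ≡ - b
  b^q≡-b⇒b^q³≡-b {b} b^q≡-b = trans (^q³≡^q²^q b) (trans (cong (_^ q) (b^q≡-b⇒b^q²≡b b^q≡-b)) b^q≡-b)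

  b^q≡-b⇒bb^q²≡b^qb^q³ : ∀ {b} → b ^ q ≡ - b → b * b ^ (q ℕ.^ 2) ≡ b ^ q * b ^ (q ℕ.^ 3)
  b^q≡-b⇒bb^q²≡b^qb^q³ {b} b^q≡-b = begin
    b * b ^ (q ℕ.^ 2)          ≡⟨ cong (b *_) (b^q≡-b⇒b^q²≡b b^q≡-b) ⟩
    b * b                      ≡⟨ solve 1 (λ b → b :* b := (:- b) :* (:- b)) refl b ⟩
    - b * - b                  ≡⟨ cong₂ _*_ b^q≡-b (b^q≡-b⇒b^q³≡-b b^q≡-b) ⟨
    b ^ q * b ^ (q ℕ.^ 3)      ∎

  trace≡0⇒x^q≡-x : ∀ {x} → x ≢ 0# → x * x ^ (q ℕ.^ 2) ≡ x ^ q * x ^ (q ℕ.^ 3) →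
    x + x ^ q + x ^ (q ℕ.^ 2) + x ^ (q ℕ.^ 3) ≡ 0# → x ^ q ≡ - x
  trace≡0⇒x^q≡-x {x} x≢0 xx₂≡x₁x₃ trace≡0 = conclude (*≡0⇒≡0 factorisation)
    where
    x₁ = x ^ q
    x₂ = x ^ (q ℕ.^ 2)
    x₃ = x ^ (q ℕ.^ 3)

    factorisation : (x + x₁) * (x * (x₁ + x₂)) ≡ 0#
    factorisation = begin
      (x + x₁) * (x * (x₁ + x₂))
        ≡⟨ solve 4 (λ x x₁ x₂ x₃ → (x :+ x₁) :* (x :* (x₁ :+ x₂))
                      := x :* x₁ :* (x :+ x₁ :+ x₂ :+ x₃) :+ x :* (x :* x₂ :- x₁ :* x₃))
                   refl x x₁ x₂ x₃ ⟩
      x * x₁ * (x + x₁ + x₂ + x₃) + x * (x * x₂ - x₁ * x₃)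
        ≡⟨ cong₂ (λ s d → x * x₁ * s + x * d) trace≡0 (x≈y⇒x∙y⁻¹≈ε xx₂≡x₁x₃) ⟩
      x * x₁ * 0# + x * 0#
        ≡⟨ cong₂ _+_ (zeroʳ (x * x₁)) (zeroʳ x) ⟩
      0# + 0#
        ≡⟨ +-identityʳ 0# ⟩
      0#  ∎

    x₁+x₂≡0⇒x₁≡-x : x₁ + x₂ ≡ 0# → x₁ ≡ - x
    x₁+x₂≡0⇒x₁≡-x x₁+x₂≡0 = ^q-injective (begin
      x₁ ^ q       ≡⟨ ^q²≡^q^q x ⟨
      x₂           ≡⟨ +-inverseʳ-unique x₁ x₂ x₁+x₂≡0 ⟩
      - x₁         ≡⟨ -‿^q x ⟨
      (- x) ^ q    ∎)

    conclude : x + x₁ ≡ 0# ⊎ x * (x₁ + x₂) ≡ 0# → x₁ ≡ - x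
    conclude (inj₁ x+x₁≡0)     = +-inverseʳ-unique x x₁ x+x₁≡0
    conclude (inj₂ x[x₁+x₂]≡0) = Sum.[_,_] (⊥-elim ∘ x≢0) x₁+x₂≡0⇒x₁≡-x (*≡0⇒≡0 x[x₁+x₂]≡0)

  trace≡0⇒[bb^q²≡b^qb^q³⇔b^q≡-b] : ∀ {b} → b ≢ 0# → b + b ^ q + b ^ (q ℕ.^ 2) + b ^ (q ℕ.^ 3) ≡ 0# →
    b * b ^ (q ℕ.^ 2) ≡ b ^ q * b ^ (q ℕ.^ 3) ⇔ b ^ q ≡ - b
  trace≡0⇒[bb^q²≡b^qb^q³⇔b^q≡-b] b≢0 trace≡0 =
    mk⇔ (λ bb^q²≡b^qb^q³ → trace≡0⇒x^q≡-x b≢0 bb^q²≡b^qb^q³ trace≡0) b^q≡-b⇒bb^q²≡b^qb^q³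

  b^q≡-b⇒trace[bx]≡0⇒x^q≡x : ∀ {b x} → b ≢ 0# → b ^ q ≡ - b → x ≢ 0# →
    x * x ^ (q ℕ.^ 2) ≡ x ^ q * x ^ (q ℕ.^ 3) →
    b * x + b ^ q * x ^ q + b ^ (q ℕ.^ 2) * x ^ (q ℕ.^ 2) + b ^ (q ℕ.^ 3) * x ^ (q ℕ.^ 3) ≡ 0# →
    x ^ q ≡ x
  b^q≡-b⇒trace[bx]≡0⇒x^q≡x {b} {x} b≢0 b^q≡-b x≢0 xx₂≡x₁x₃ trace[bx]≡0 =
    *-cancelˡ b≢0 (-‿injective (begin
      - (b * x ^ q)    ≡⟨ -‿distribˡ-* b (x ^ q) ⟩
      - b * x ^ q      ≡⟨ cong (_* x ^ q) b^q≡-b ⟨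
      b ^ q * x ^ q    ≡⟨ ^-distrib-* b x q ⟨
      (b * x) ^ q      ≡⟨ trace≡0⇒x^q≡-x (*-≢0 b≢0 x≢0) relation trace≡0 ⟩
      - (b * x)        ∎))
    where
    relation : (b * x) * (b * x) ^ (q ℕ.^ 2) ≡ (b * x) ^ q * (b * x) ^ (q ℕ.^ 3)
    relation rewrite ^-distrib-* b x q | ^-distrib-* b x (q ℕ.^ 2) | ^-distrib-* b x (q ℕ.^ 3) = begin
      (b * x) * (b ^ (q ℕ.^ 2) * x ^ (q ℕ.^ 2))
        ≡⟨ solve 4 (λ b x b₂ x₂ → (b :* x) :* (b₂ :* x₂) := (b :* b₂) :* (x :* x₂)) refl b x _ _ ⟩
      (b * b ^ (q ℕ.^ 2)) * (x * x ^ (q ℕ.^ 2))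
        ≡⟨ cong₂ _*_ (b^q≡-b⇒bb^q²≡b^qb^q³ b^q≡-b) xx₂≡x₁x₃ ⟩
      (b ^ q * b ^ (q ℕ.^ 3)) * (x ^ q * x ^ (q ℕ.^ 3))
        ≡⟨ solve 4 (λ b₁ b₃ x₁ x₃ → (b₁ :* b₃) :* (x₁ :* x₃) := (b₁ :* x₁) :* (b₃ :* x₃))
                   refl _ _ _ _ ⟩
      (b ^ q * x ^ q) * (b ^ (q ℕ.^ 3) * x ^ (q ℕ.^ 3))   ∎
    trace≡0 : b * x + (b * x) ^ q + (b * x) ^ (q ℕ.^ 2) + (b * x) ^ (q ℕ.^ 3) ≡ 0#
    trace≡0 rewrite ^-distrib-* b x q | ^-distrib-* b x (q ℕ.^ 2) | ^-distrib-* b x (q ℕ.^ 3) = trace[bx]≡0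

module ProjectiveSpace (q : ℕ) (K : FiniteField (q ℕ.^ 4)) (α : FiniteField.F K) where
  open ≡
  open ≡-Reasoning
  open FieldProperties K
  open Setup q K α using (⟨_,_,_,_⟩; _∼_; OnPlane; det3; conicMatrix; half)

  ∼-refl : ∀ {P} → P ∼ P
  ∼-refl {⟨ x , y , z , t ⟩} =
    1# , 1≢0 , sym (*-identityˡ x) , sym (*-identityˡ y) , sym (*-identityˡ z) , sym (*-identityˡ t)

  ∼-sym : ∀ {P Q} → P ∼ Q → Q ∼ P
  ∼-sym (c , c≢0 , x′ , y′ , z′ , t′) =
    c ⁻¹ , ⁻¹-≢0 c≢0 , unscale x′ , unscale y′ , unscale z′ , unscale t′
    where
    unscale : ∀ {u v} → v ≡ c * u → u ≡ c ⁻¹ * v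
    unscale {u} v≡cu = trans (sym (⁻¹*-cancel u c≢0)) (cong (c ⁻¹ *_) (sym v≡cu))

  ∼-trans : ∀ {P Q R} → P ∼ Q → Q ∼ R → P ∼ R
  ∼-trans (c , c≢0 , x′ , y′ , z′ , t′) (d , d≢0 , x″ , y″ , z″ , t″) =
    d * c , *-≢0 d≢0 c≢0 , rescale x′ x″ , rescale y′ y″ , rescale z′ z″ , rescale t′ t″
    where
    rescale : ∀ {u v w} → v ≡ c * u → w ≡ d * v → w ≡ (d * c) * u
    rescale {u} v≡cu w≡dv = trans w≡dv (trans (cong (d *_) v≡cu) (sym (*-assoc d c u)))

  OnPlane-∼ : ∀ {b P Q} → OnPlane b P → P ∼ Q → OnPlane b Q
  OnPlane-∼ {b} {⟨ x , y , z , t ⟩} P∈plane (c , _ , refl , refl , refl , refl) = begin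
    b * (c * x) + b ^ q * (c * y) + b ^ (q ℕ.^ 2) * (c * z) + b ^ (q ℕ.^ 3) * (c * t)
      ≡⟨ solve 9 (λ c x y z t b b₁ b₂ b₃ →
              b :* (c :* x) :+ b₁ :* (c :* y) :+ b₂ :* (c :* z) :+ b₃ :* (c :* t)
           := c :* (b :* x :+ b₁ :* y :+ b₂ :* z :+ b₃ :* t))
           refl c x y z t b (b ^ q) (b ^ (q ℕ.^ 2)) (b ^ (q ℕ.^ 3)) ⟩
    c * (b * x + b ^ q * y + b ^ (q ℕ.^ 2) * z + b ^ (q ℕ.^ 3) * t)
      ≡⟨ cong (c *_) P∈plane ⟩
    c * 0#
      ≡⟨ zeroʳ c ⟩
    0# ∎

  half+half≡1 : 1# + 1# ≢ 0# → half + half ≡ 1#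
  half+half≡1 2≢0 = begin
    half + half               ≡⟨ cong₂ _+_ (*-identityˡ half) (*-identityˡ half) ⟨
    1# * half + 1# * half     ≡⟨ distribʳ half 1# 1# ⟨
    (1# + 1#) * half          ≡⟨ inverseʳ (1# + 1#) 2≢0 ⟩
    1#                        ∎

  det-conicMatrix : 1# + 1# ≢ 0# → ∀ b → det3 (conicMatrix b) ≡
    half * half * (b ^ (q ℕ.^ 3) * (b * b ^ (q ℕ.^ 2) - b ^ q * b ^ (q ℕ.^ 3)))
  det-conicMatrix 2≢0 b = begin
    det3 (conicMatrix b)
      ≡⟨ cong expansion (-‿inverseʳ 0#) ⟨
    expansion (0# - 0#)
      ≡⟨ solve 5 (λ h b b₁ b₂ b₃ →
             con (0 , 0) :* (b₁ :* con (0 , 0) :- (h :* b₂) :* (h :* b₂))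
           :- (h :* b) :* ((h :* b) :* con (0 , 0) :- (h :* b₂) :* (h :* b₃))
           :+ (h :* b₃) :* ((h :* b) :* (h :* b₂) :- b₁ :* (h :* b₃))
           := h :* h :* (b₃ :* ((h :+ h) :* (b :* b₂) :- b₁ :* b₃)))
           refl half b b₁ b₂ b₃ ⟩
    half * half * (b₃ * ((half + half) * (b * b₂) - b₁ * b₃))
      ≡⟨ cong (λ s → half * half * (b₃ * (s * (b * b₂) - b₁ * b₃))) (half+half≡1 2≢0) ⟩
    half * half * (b₃ * (1# * (b * b₂) - b₁ * b₃))
      ≡⟨ cong (λ s → half * half * (b₃ * (s - b₁ * b₃))) (*-identityˡ (b * b₂)) ⟩
    half * half * (b₃ * (b * b₂ - b₁ * b₃)) ∎
    where
    b₁ = b ^ q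
    b₂ = b ^ (q ℕ.^ 2)
    b₃ = b ^ (q ℕ.^ 3)
    -- The solver denotes the constant 0 by 0# - 0#, so the zero entries of the
    -- matrix are abstracted as o and instantiated with 0# - 0#.
    expansion : F → F
    expansion o = o * (b₁ * o - (half * b₂) * (half * b₂))
      - (half * b) * ((half * b) * o - (half * b₂) * (half * b₃))
      + (half * b₃) * ((half * b) * (half * b₂) - b₁ * (half * b₃))

  det≡0⇔ : 1# + 1# ≢ 0# → ∀ {b} → b ≢ 0# →
    det3 (conicMatrix b) ≡ 0# ⇔ b * b ^ (q ℕ.^ 2) ≡ b ^ q * b ^ (q ℕ.^ 3)
  det≡0⇔ 2≢0 {b} b≢0 = mk⇔ singular⇒ ⇒singular
    where
    b₁ = b ^ q
    b₂ = b ^ (q ℕ.^ 2)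
    b₃ = b ^ (q ℕ.^ 3)

    half≢0 : half ≢ 0#
    half≢0 half≡0 = 1≢0 (begin
      1#                  ≡⟨ inverseʳ (1# + 1#) 2≢0 ⟨
      (1# + 1#) * half    ≡⟨ cong ((1# + 1#) *_) half≡0 ⟩
      (1# + 1#) * 0#      ≡⟨ zeroʳ (1# + 1#) ⟩
      0#                  ∎)

    singular⇒ : det3 (conicMatrix b) ≡ 0# → b * b₂ ≡ b₁ * b₃
    singular⇒ det≡0 = from-factors (*≡0⇒≡0 (trans (sym (det-conicMatrix 2≢0 b)) det≡0))
      where
      from-factors : half * half ≡ 0# ⊎ b₃ * (b * b₂ - b₁ * b₃) ≡ 0# → b * b₂ ≡ b₁ * b₃
      from-factors (inj₁ half²≡0) = ⊥-elim (*-≢0 half≢0 half≢0 half²≡0)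
      from-factors (inj₂ b₃[bb₂-b₁b₃]≡0) =
        Sum.[_,_] (⊥-elim ∘ ^-≢0 (q ℕ.^ 3) b≢0) (x∙y⁻¹≈ε⇒x≈y (b * b₂) (b₁ * b₃))
                  (*≡0⇒≡0 b₃[bb₂-b₁b₃]≡0)

    ⇒singular : b * b₂ ≡ b₁ * b₃ → det3 (conicMatrix b) ≡ 0#
    ⇒singular bb₂≡b₁b₃ = begin
      det3 (conicMatrix b)                       ≡⟨ det-conicMatrix 2≢0 b ⟩
      half * half * (b₃ * (b * b₂ - b₁ * b₃))
        ≡⟨ cong (λ d → half * half * (b₃ * d)) (x≈y⇒x∙y⁻¹≈ε bb₂≡b₁b₃) ⟩
      half * half * (b₃ * 0#)                    ≡⟨ cong (half * half *_) (zeroʳ b₃) ⟩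
      half * half * 0#                           ≡⟨ zeroʳ _ ⟩
      0#                                         ∎

-- q = 3 + 2r is the odd prime power, S = q − 1, N = (q² + 1)(q + 1),
-- U = N / 2, M = q⁴ − 1 (the order of α) and H = M / 2. The primed versions
-- are the same polynomials in r, for the solver.
module Arithmetic (r : ℕ) where
  open ≡
  open import Data.Nat
  open import Data.Nat.DivMod using (m*n/n≡m)
  open import Data.Nat.Properties using (m<m+n; *-monoˡ-<; *-monoˡ-≤; *-cancelʳ-≡; *-assoc; module ≤-Reasoning)
  open import Data.Nat.Solver using (module +-*-Solver)
  open +-*-Solver using (Polynomial; solve; _:=_; _:+_; _:*_; _:^_; con)
  open ≤-Reasoning

  q S N U H M : ℕ
  q = 3 + 2 * r
  S = 2 + 2 * r
  N = (q ^ 2 + 1) * (q + 1)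
  U = (q ^ 2 + 1) * (2 + r)
  H = U * S
  M = H + H

  private
    q′ S′ U′ M′ : ∀ {k} → Polynomial k → Polynomial k
    q′ ρ = con 3 :+ con 2 :* ρ
    S′ ρ = con 2 :+ con 2 :* ρ
    U′ ρ = (q′ ρ :^ 2 :+ con 1) :* (con 2 :+ ρ)
    M′ ρ = U′ ρ :* S′ ρ :+ U′ ρ :* S′ ρ

  q⁴≡1+M : q ^ 4 ≡ suc M
  q⁴≡1+M = solve 1 (λ ρ → q′ ρ :^ 4 := con 1 :+ M′ ρ) refl r

  S≡k+k : S ≡ suc r + suc r
  S≡k+k = solve 1 (λ ρ → S′ ρ := (con 1 :+ ρ) :+ (con 1 :+ ρ)) refl r

  N/2≡U : N / 2 ≡ U
  N/2≡U = trans (cong (_/ 2) N≡U*2) (m*n/n≡m U 2)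
    where
    N≡U*2 : N ≡ U * 2
    N≡U*2 = solve 1 (λ ρ → (q′ ρ :^ 2 :+ con 1) :* (q′ ρ :+ con 1) := U′ ρ :* con 2) refl r

  conjugate-exponents : ∀ i → let l = i * (q + 1) in l * q + l * q ^ 3 ≡ (l + l * q ^ 2) + i * M
  conjugate-exponents = solve 2 (λ ρ i →
      i :* (q′ ρ :+ con 1) :* q′ ρ :+ i :* (q′ ρ :+ con 1) :* q′ ρ :^ 3
    := (i :* (q′ ρ :+ con 1) :+ i :* (q′ ρ :+ con 1) :* q′ ρ :^ 2) :+ i :* M′ ρ) refl r

  1<M : 1 < M
  1<M = s≤s (s≤s z≤n)

  H<M : H < M
  H<M = m<m+n H (s≤s z≤n)

  u<N⇒uS<M : ∀ {u} → u < N → u * S < M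
  u<N⇒uS<M {u} u<N = begin-strict
    u * S      <⟨ *-monoˡ-< S u<N ⟩
    N * S      ≡⟨ solve 1 (λ ρ → (q′ ρ :^ 2 :+ con 1) :* (q′ ρ :+ con 1) :* S′ ρ := M′ ρ) refl r ⟩
    M          ∎

  uS≡H⇒u≡U : ∀ {u} → u * S ≡ H → u ≡ U
  uS≡H⇒u≡U {u} = *-cancelʳ-≡ u U S

  i≤q²⇒i[q+1]S<M : ∀ {i} → i ≤ q ^ 2 → i * (q + 1) * S < M
  i≤q²⇒i[q+1]S<M {i} i≤q² = begin-strict
    i * (q + 1) * S                         ≡⟨ *-assoc i (q + 1) S ⟩
    i * ((q + 1) * S)                       ≤⟨ *-monoˡ-≤ ((q + 1) * S) i≤q² ⟩
    q ^ 2 * ((q + 1) * S)                   <⟨ m<m+n (q ^ 2 * ((q + 1) * S)) (s≤s z≤n) ⟩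
    q ^ 2 * ((q + 1) * S) + (q + 1) * S     ≡⟨ solve 1 (λ ρ → q′ ρ :^ 2 :* ((q′ ρ :+ con 1) :* S′ ρ)
                                                              :+ (q′ ρ :+ con 1) :* S′ ρ := M′ ρ) refl r ⟩
    M                                       ∎

  i[q+1]S≡0⇒i≡0 : ∀ {i} → i * (q + 1) * S ≡ 0 → i ≡ 0
  i[q+1]S≡0⇒i≡0 {i} i[q+1]S≡0 = *-cancelʳ-≡ i 0 ((q + 1) * S) (trans (sym (*-assoc i (q + 1) S)) i[q+1]S≡0)

module OddNumbers where
  open ≡
  open import Data.Nat
  open import Data.Nat.Properties using (+-suc; *-comm; *-identityʳ)
  open import Data.Nat.Divisibility using (divides)
  open import Data.Nat.Primality using (Prime; prime⇒irreducible; ¬prime[1])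
  open import Data.Nat.Tactic.RingSolver using (solve-∀)

  even⊎odd : ∀ n → (∃ λ a → n ≡ 2 * a) ⊎ (∃ λ a → n ≡ suc (2 * a))
  even⊎odd zero    = inj₁ (0 , refl)
  even⊎odd (suc n) with even⊎odd n
  ... | inj₁ (a , n≡2a)   = inj₂ (a , cong suc n≡2a)
  ... | inj₂ (a , n≡1+2a) = inj₁ (suc a , cong suc (trans n≡1+2a (sym (+-suc a (a + 0)))))

  odd-prime : ∀ {p} → Prime p → p ≢ 2 → ∃ λ a → p ≡ 3 + 2 * a
  odd-prime {p} p-prime p≢2 with even⊎odd p
  ... | inj₁ (a , p≡2a) with prime⇒irreducible p-prime (divides a (trans p≡2a (*-comm 2 a)))
  ...   | inj₁ ()
  ...   | inj₂ 2≡p = ⊥-elim (p≢2 (sym 2≡p))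
  odd-prime p-prime p≢2 | inj₂ (zero  , refl)   = ⊥-elim (¬prime[1] p-prime)
  odd-prime p-prime p≢2 | inj₂ (suc a , p≡1+2a) = a , trans p≡1+2a (cong (suc ∘ suc) (+-suc a (a + 0)))

  odd-power : ∀ a k → ∃ λ c → (3 + 2 * a) ^ suc k ≡ 3 + 2 * c
  odd-power a zero    = a , *-identityʳ (3 + 2 * a)
  odd-power a (suc k) with odd-power a k
  ... | c , p^k≡3+2c = 3 + 3 * a + 3 * c + 2 * a * c , trans (cong ((3 + 2 * a) *_) p^k≡3+2c) (product a c)
    where
    product : ∀ a c → (3 + 2 * a) * (3 + 2 * c) ≡ 3 + 2 * (3 + 3 * a + 3 * c + 2 * a * c)
    product = solve-∀

  oddPrimePower⇒≡3+2* : ∀ {q} → OddPrimePower q → ∃ λ r → q ≡ 3 + 2 * r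
  oddPrimePower⇒≡3+2* (p , suc k , p-prime , p≢2 , _ , q≡p^k) with odd-prime p-prime p≢2
  ... | a , refl = let c , p^k≡3+2c = odd-power a k in c , trans q≡p^k p^k≡3+2c

module PlaneSection (r : ℕ) (K : FiniteField ((3 ℕ.+ 2 ℕ.* r) ℕ.^ 4)) (α : FiniteField.F K)
                    (α-primitive : FiniteField.IsPrimitive K α) where
  open ≡
  open Arithmetic r
  open FieldProperties K
  open PrimitiveElement K q⁴≡1+M 1<M α α-primitive
  open Frobenius K q {suc r} (cong suc S≡k+k) (λ x → trans (cong (x ^_) q⁴≡1+M) (^[1+m]≡id x))
  open ProjectiveSpace q K α
  open Setup q K α using (_∼_; ω; InO; OnPlane; det3; conicMatrix; NonSingularConic; ExactlyOneOnPlane; InD)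

  ^q≡-x⇔^S≡-1 : ∀ {x} → x ≢ 0# → x ^ q ≡ - x ⇔ x ^ S ≡ - 1#
  ^q≡-x⇔^S≡-1 {x} x≢0 = mk⇔ (λ x^q≡-x → *-cancelˡ x≢0 (trans x^q≡-x -x≡x*-1))
                             (λ x^S≡-1 → trans (cong (x *_) x^S≡-1) (sym -x≡x*-1))
    where
    -x≡x*-1 : - x ≡ x * - 1#
    -x≡x*-1 = trans (cong -_ (sym (*-identityʳ x))) (-‿distribʳ-* x 1#)

  α^H≡-1 : α ^ H ≡ - 1#
  α^H≡-1 = α^h≡-1 {H} refl

  [α^U]^S≡-1 : (α ^ U) ^ S ≡ - 1#
  [α^U]^S≡-1 = trans (^-assocʳ α U S) α^H≡-1

  [α^u]^q≡-α^u⇔u≡U : ∀ {u} → u ℕ.< N → (α ^ u) ^ q ≡ - (α ^ u) ⇔ u ≡ U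
  [α^u]^q≡-α^u⇔u≡U {u} u<N = ⇔.trans (^q≡-x⇔^S≡-1 (^-≢0 u α≢0)) (mk⇔ ⇒u≡U u≡U⇒)
    where
    ⇒u≡U : (α ^ u) ^ S ≡ - 1# → u ≡ U
    ⇒u≡U [α^u]^S≡-1 = uS≡H⇒u≡U (^-injective (u<N⇒uS<M u<N) H<M
      (trans (sym (^-assocʳ α u S)) (trans [α^u]^S≡-1 (sym α^H≡-1))))
    u≡U⇒ : u ≡ U → (α ^ u) ^ S ≡ - 1#
    u≡U⇒ refl = [α^U]^S≡-1

  singular⇔u≡N/2 : ∀ {u} → InD u → det3 (conicMatrix (α ^ u)) ≡ 0# ⇔ u ≡ N / 2
  singular⇔u≡N/2 {u} (u<N , trace≡0) = begin
    det3 (conicMatrix b) ≡ 0#                   ≈⟨ det≡0⇔ (1+1≢0 {H} refl) b≢0 ⟩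
    b * b ^ (q ℕ.^ 2) ≡ b ^ q * b ^ (q ℕ.^ 3)   ≈⟨ trace≡0⇒[bb^q²≡b^qb^q³⇔b^q≡-b] b≢0 trace≡0 ⟩
    b ^ q ≡ - b                                 ≈⟨ [α^u]^q≡-α^u⇔u≡U u<N ⟩
    u ≡ U                                       ≡⟨ cong (u ≡_) (sym N/2≡U) ⟩
    u ≡ N / 2                                   ∎
    where
    open import Relation.Binary.Reasoning.Setoid (⇔.⇔-setoid 0ℓ)
    b = α ^ u
    b≢0 = ^-≢0 u α≢0

  [α^U]^q≡-α^U : (α ^ U) ^ q ≡ - (α ^ U)
  [α^U]^q≡-α^U = Equivalence.from (^q≡-x⇔^S≡-1 (^-≢0 U α≢0)) [α^U]^S≡-1

  O∩plane⊆ω0 : ∀ {P} → InO P → OnPlane (α ^ U) P → P ∼ ω 0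
  O∩plane⊆ω0 {P} (i , i≤q² , P∼ωl) P∈plane = subst (λ j → P ∼ ω (j ℕ.* (q ℕ.+ 1))) i≡0 P∼ωl
    where
    open ≡-Reasoning
    l = i ℕ.* (q ℕ.+ 1)

    α^iM≡1 : α ^ (i ℕ.* M) ≡ 1#
    α^iM≡1 = trans (sym (^-assocʳ α i M)) (^m≡1 (^-≢0 i α≢0))

    relation : α ^ l * (α ^ l) ^ (q ℕ.^ 2) ≡ (α ^ l) ^ q * (α ^ l) ^ (q ℕ.^ 3)
    relation rewrite ^-assocʳ α l q | ^-assocʳ α l (q ℕ.^ 2) | ^-assocʳ α l (q ℕ.^ 3) = begin
      α ^ l * α ^ (l ℕ.* q ℕ.^ 2)                   ≡⟨ ^-homo-* α l (l ℕ.* q ℕ.^ 2) ⟨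
      α ^ (l ℕ.+ l ℕ.* q ℕ.^ 2)                     ≡⟨ *-identityʳ (α ^ (l ℕ.+ l ℕ.* q ℕ.^ 2)) ⟨
      α ^ (l ℕ.+ l ℕ.* q ℕ.^ 2) * 1#                ≡⟨ cong (α ^ (l ℕ.+ l ℕ.* q ℕ.^ 2) *_) α^iM≡1 ⟨
      α ^ (l ℕ.+ l ℕ.* q ℕ.^ 2) * α ^ (i ℕ.* M)     ≡⟨ ^-homo-* α (l ℕ.+ l ℕ.* q ℕ.^ 2) (i ℕ.* M) ⟨
      α ^ (l ℕ.+ l ℕ.* q ℕ.^ 2 ℕ.+ i ℕ.* M)         ≡⟨ cong (α ^_) (conjugate-exponents i) ⟨
      α ^ (l ℕ.* q ℕ.+ l ℕ.* q ℕ.^ 3)               ≡⟨ ^-homo-* α (l ℕ.* q) (l ℕ.* q ℕ.^ 3) ⟩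
      α ^ (l ℕ.* q) * α ^ (l ℕ.* q ℕ.^ 3)           ∎

    ωl∈plane : α ^ U * α ^ l + (α ^ U) ^ q * (α ^ l) ^ q + (α ^ U) ^ (q ℕ.^ 2) * (α ^ l) ^ (q ℕ.^ 2)
               + (α ^ U) ^ (q ℕ.^ 3) * (α ^ l) ^ (q ℕ.^ 3) ≡ 0#
    ωl∈plane rewrite ^-assocʳ α l q | ^-assocʳ α l (q ℕ.^ 2) | ^-assocʳ α l (q ℕ.^ 3) = OnPlane-∼ P∈plane P∼ωl

    [α^l]^S≡1 : (α ^ l) ^ S ≡ 1#
    [α^l]^S≡1 = *-cancelˡ (^-≢0 l α≢0) (trans
      (b^q≡-b⇒trace[bx]≡0⇒x^q≡x (^-≢0 U α≢0) [α^U]^q≡-α^U (^-≢0 l α≢0) relation ωl∈plane)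
      (sym (*-identityʳ (α ^ l))))

    i≡0 : i ≡ 0
    i≡0 = i[q+1]S≡0⇒i≡0 (^-injective (i≤q²⇒i[q+1]S<M i≤q²) (ℕP.<-trans ℕP.0<1+n 1<M)
      (trans (sym (^-assocʳ α l S)) [α^l]^S≡1))

  ω0∈plane : OnPlane (α ^ U) (ω 0)
  ω0∈plane = begin
    b * 1# + b ^ q * 1# + b ^ (q ℕ.^ 2) * 1# + b ^ (q ℕ.^ 3) * 1#
      ≡⟨ cong₂ (λ b₁ b₃ → b * 1# + b₁ * 1# + b ^ (q ℕ.^ 2) * 1# + b₃ * 1#)
               [α^U]^q≡-α^U (b^q≡-b⇒b^q³≡-b [α^U]^q≡-α^U) ⟩
    b * 1# + - b * 1# + b ^ (q ℕ.^ 2) * 1# + - b * 1#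
      ≡⟨ cong (λ b₂ → b * 1# + - b * 1# + b₂ * 1# + - b * 1#) (b^q≡-b⇒b^q²≡b [α^U]^q≡-α^U) ⟩
    b * 1# + - b * 1# + b * 1# + - b * 1#
      ≡⟨ solve 2 (λ b o → b :* o :+ (:- b) :* o :+ b :* o :+ (:- b) :* o := (b :- b) :* (o :+ o)) refl b 1# ⟩
    (b - b) * (1# + 1#)
      ≡⟨ cong (_* (1# + 1#)) (-‿inverseʳ b) ⟩
    0# * (1# + 1#)
      ≡⟨ zeroˡ (1# + 1#) ⟩
    0# ∎
    where
    open ≡-Reasoning
    b = α ^ U

  exactlyOne : ExactlyOneOnPlane (α ^ U)
  exactlyOne = (ω 0 , (0 , ℕ.z≤n , ∼-refl) , ω0∈plane) ,
    λ P Q P∈O P∈plane Q∈O Q∈plane → ∼-trans (O∩plane⊆ω0 P∈O P∈plane) (∼-sym (O∩plane⊆ω0 Q∈O Q∈plane))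

  theorem : ∀ {u} → InD u →
    (NonSingularConic (α ^ u) ⇔ (u ≢ N / 2)) × (u ≡ N / 2 → ExactlyOneOnPlane (α ^ u))
  theorem u∈D = ¬-cong-⇔ (singular⇔u≡N/2 u∈D) ,
    λ u≡N/2 → subst (ExactlyOneOnPlane ∘ (α ^_)) (sym (trans u≡N/2 N/2≡U)) exactlyOne

mainTheorem17 : (q : ℕ) → OddPrimePower q →
    (K : FiniteField (q Data.Nat.^ 4)) → (α : FiniteField.F K) →
    FiniteField.IsPrimitive K α →
    (u : ℕ) → Setup.InD q K α u →
    (Setup.NonSingularConic q K α (FiniteField._^_ K α u) ⇔ (u ≢ Setup.N q K α / 2)) ×
    (u ≡ Setup.N q K α / 2 → Setup.ExactlyOneOnPlane q K α (FiniteField._^_ K α u))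
mainTheorem17 q q-odd with OddNumbers.oddPrimePower⇒≡3+2* q-odd
... | r , ≡.refl = λ K α α-primitive u u∈D → PlaneSection.theorem r K α α-primitive u∈D
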